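{- Let $(L,\vee,\wedge,{}^*,0,1)$ be a distributive pseudocomplemented lattice, define $x\rightarrow y:=x^*\vee y$ and $x\Rightarrow y:=x^*\vee y^{**}$, and let $a,b,c\in L$. Then: (i) $a\wedge(a\Rightarrow b)\le b^{**}$; (ii) $a\le b\Rightarrow c$ implies $a\wedge b\le c^{**}$; (iii) if $a\rightarrow b=a\Rightarrow b$ then $a^{**}\wedge b=a^{**}\wedge b^{**}$.
   Context: A bounded lattice $(L,\vee,\wedge,0,1)$ is pseudocomplemented if for each $a\in L$ there is a greatest element $a^*\in L$ with $a\wedge a^*=0$; $a^*$ is the pseudocomplement of $a$. -}

module Defs where

open import Level using (Level; _⊔_) renaming (suc to lsuc)
open import Data.Product using (_×_)
open import Relation.Binary.Definitions using (Minimum; Maximum)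
open import Relation.Binary.Lattice.Bundles using (DistributiveLattice)

record DistributivePseudocomplementedLattice (c ℓ₁ ℓ₂ : Level)
       : Set (lsuc (c ⊔ ℓ₁ ⊔ ℓ₂)) where
  field
    distributiveLattice : DistributiveLattice c ℓ₁ ℓ₂
  open DistributiveLattice distributiveLattice public
  field
    𝟘 : Carrier
    𝟙 : Carrier
    𝟘-minimum : Minimum _≤_ 𝟘
    𝟙-maximum : Maximum _≤_ 𝟙
    _* : Carrier → Carrier
    *-disjoint : ∀ a → (a ∧ (a *)) ≈ 𝟘
    *-greatest : ∀ a x → (a ∧ x) ≈ 𝟘 → x ≤ (a *)

  infixl 10 _*
  infixr 5 _→ᵖ_ _⇒ᵖ_

  _→ᵖ_ : Carrier → Carrier → Carrier
  x →ᵖ y = (x *) ∨ y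

  _⇒ᵖ_ : Carrier → Carrier → Carrier
  x ⇒ᵖ y = (x *) ∨ ((y *) *)

module Submission where

open import Defs
open import Level using (Level)
open import Data.Product using (_×_; _,_)
import Relation.Binary.Lattice.Properties.MeetSemilattice as MeetProperties

-- All three parts rest on one consequence of distributivity: if z ∧ w = 0
-- then z ∧ (w ∨ y) = (z ∧ w) ∨ (z ∧ y) ≤ z ∧ y.  With z = x, w = x* this is
-- modus ponens x ∧ (x → y) ≤ y, which gives (i) and (ii); with z = x**,
-- w = x* it shows that x → y = x ⇒ y forces y** ≤ x* ∨ y and hence (iii).

module Pseudocomplement {ℓc ℓ₁ ℓ₂ : Level}
  (L : DistributivePseudocomplementedLattice ℓc ℓ₁ ℓ₂) where

  open DistributivePseudocomplementedLattice L
  open MeetProperties meetSemilattice using (∧-comm; ∧-monotonic)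

  ≈𝟘⇒≤ : ∀ {x y} → x ≈ 𝟘 → x ≤ y
  ≈𝟘⇒≤ {y = y} x≈𝟘 = trans (reflexive x≈𝟘) (𝟘-minimum y)

  disjoint⇒∧-∨≤∧ : ∀ z w y → (z ∧ w) ≈ 𝟘 → (z ∧ (w ∨ y)) ≤ (z ∧ y)
  disjoint⇒∧-∨≤∧ z w y z∧w≈𝟘 =
    trans (reflexive (∧-distribˡ-∨ z w y)) (∨-least (≈𝟘⇒≤ z∧w≈𝟘) refl)

  *-disjointˡ : ∀ x → ((x *) ∧ x) ≈ 𝟘
  *-disjointˡ x = Eq.trans (∧-comm (x *) x) (*-disjoint x)

  x≤x** : ∀ x → x ≤ ((x *) *)
  x≤x** x = *-greatest (x *) x (*-disjointˡ x)

  →ᵖ-eval : ∀ x y → (x ∧ (x →ᵖ y)) ≤ y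
  →ᵖ-eval x y = trans (disjoint⇒∧-∨≤∧ x (x *) y (*-disjoint x)) (x∧y≤y x y)

  ⇒ᵖ-eval : ∀ x y → (x ∧ (x ⇒ᵖ y)) ≤ ((y *) *)
  ⇒ᵖ-eval x y = →ᵖ-eval x ((y *) *)

  ≤⇒ᵖ⇒∧≤** : ∀ {x y z} → x ≤ (y ⇒ᵖ z) → (x ∧ y) ≤ ((z *) *)
  ≤⇒ᵖ⇒∧≤** {x} {y} {z} x≤y⇒z = begin
    x ∧ y              ≤⟨ ∧-greatest (trans (x∧y≤x x y) x≤y⇒z) (x∧y≤y x y) ⟩
    (y ⇒ᵖ z) ∧ y       ≈⟨ ∧-comm (y ⇒ᵖ z) y ⟩
    y ∧ (y ⇒ᵖ z)       ≤⟨ ⇒ᵖ-eval y z ⟩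
    (z *) *            ∎
    where open import Relation.Binary.Reasoning.PartialOrder poset

  →ᵖ≈⇒ᵖ⇒**∧≈**∧** : ∀ {x y} → (x →ᵖ y) ≈ (x ⇒ᵖ y)
                   → (((x *) *) ∧ y) ≈ (((x *) *) ∧ ((y *) *))
  →ᵖ≈⇒ᵖ⇒**∧≈**∧** {x} {y} →≈⇒ = antisym
    (∧-monotonic refl (x≤x** y))
    (begin
      x** ∧ y**            ≤⟨ ∧-monotonic refl y**≤x→y ⟩
      x** ∧ (x →ᵖ y)       ≤⟨ disjoint⇒∧-∨≤∧ x** (x *) y (*-disjointˡ (x *)) ⟩
      x** ∧ y              ∎)
    where
      open import Relation.Binary.Reasoning.PartialOrder poset
      x** y** : Carrier
      x** = (x *) *
      y** = (y *) *
      y**≤x→y : y** ≤ (x →ᵖ y)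
      y**≤x→y = trans (y≤x∨y (x *) y**) (reflexive (Eq.sym →≈⇒))

lemma4p5 : ∀ {ℓc ℓ₁ ℓ₂ : Level} (L : DistributivePseudocomplementedLattice ℓc ℓ₁ ℓ₂)
    → let open DistributivePseudocomplementedLattice L in
      ∀ (a b c : Carrier)
      → ((a ∧ (a ⇒ᵖ b)) ≤ ((b *) *))
      × (a ≤ (b ⇒ᵖ c) → (a ∧ b) ≤ ((c *) *))
      × ((a →ᵖ b) ≈ (a ⇒ᵖ b) → (((a *) *) ∧ b) ≈ (((a *) *) ∧ ((b *) *)))
lemma4p5 L a b c = ⇒ᵖ-eval a b , ≤⇒ᵖ⇒∧≤** , →ᵖ≈⇒ᵖ⇒**∧≈**∧**
  where open Pseudocomplement L
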